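{- Suppose $m\geq 2$ is even and $n$ is a positive integer. Then $\mathsf{DL}(L_{m,n}) = \frac{m+n-2}{2}$ if $n$ is even, and $\mathsf{DL}(L_{m,n}) = \frac{m+n-1}{2}$ if $n$ is odd.
   Context: $L_{m,n}$ is the $m\times n$ grid graph, i.e. the Cartesian product of a path on $m$ vertices and a path on $n$ vertices. For a finite connected graph $G=(V,E)$ with $|V|=N$ and graph distance $d$, a $k$-dispersed labelling is a bijection $\phi:\{1,\dots,N\}\to V$ with $d(\phi(i),\phi(i+1))\ge k$ for $1\le i\le N-1$; $\mathsf{DL}(G)$ is the maximum such $k$. -}

module Defs where

open import Data.Nat using (ℕ; zero; suc; _+_; _*_; _≤_; _<_; _∸_)
open import Data.Nat.Properties using (≤-refl)
open import Data.Fin using (Fin; toℕ; fromℕ<; inject₁) renaming (suc to fsuc)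
open import Data.Fin.Properties using ()
open import Data.Product using (Σ; _×_; _,_; ∃)
open import Data.Sum using (_⊎_)
open import Function.Bundles using (_⤖_; Bijection)
open import Relation.Binary.PropositionalEquality using (_≡_)

PathAdj : (m : ℕ) → Fin m → Fin m → Set
PathAdj m i j = (suc (toℕ i) ≡ toℕ j) ⊎ (suc (toℕ j) ≡ toℕ i)

-- Grid graph L_{m,n} = P_m □ P_n (Cartesian product of paths).
GridV : ℕ → ℕ → Set
GridV m n = Fin m × Fin n

GridAdj : (m n : ℕ) → GridV m n → GridV m n → Set
GridAdj m n (i , j) (i' , j') =
  (PathAdj m i i' × j ≡ j') ⊎ (i ≡ i' × PathAdj n j j')

data Walk {V : Set} (Adj : V → V → Set) : V → V → ℕ → Set where
  here  : ∀ {u} → Walk Adj u u zero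
  step  : ∀ {u v w ℓ} → Adj u v → Walk Adj v w ℓ → Walk Adj u w (suc ℓ)

DistAtLeast : {V : Set} (Adj : V → V → Set) → V → V → ℕ → Set
DistAtLeast Adj u v k = ∀ ℓ → Walk Adj u v ℓ → k ≤ ℓ

-- A k-dispersed labelling of a graph with N vertices: a bijection
-- φ : {1..N} → V (here indexed by Fin N) with d(φ(i), φ(i+1)) ≥ k.
KDispersed : {V : Set} (Adj : V → V → Set) (N : ℕ) → ℕ → Set
KDispersed {V} Adj N k =
  Σ (Fin N ⤖ V) λ φ →
    (i : ℕ) (p : suc i < N) →
      DistAtLeast Adj (Bijection.to φ (fromℕ< (≤-trans′ p)))
                      (Bijection.to φ (fromℕ< p)) k
  where
  ≤-trans′ : ∀ {a b} → suc a < b → a < b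
  ≤-trans′ {a} {b} p = Data.Nat.Properties.<-trans (Data.Nat.Properties.n<1+n a) p
    where import Data.Nat.Properties

DLIs : {V : Set} (Adj : V → V → Set) (N : ℕ) → ℕ → Set
DLIs Adj N D = KDispersed Adj N D × (∀ k → KDispersed Adj N k → k ≤ D)

-- The graph distance in L_{m,n} is the ℓ¹ distance of coordinates; write m = 2a.
-- Lower bound: when 2e < n, give the even labels to the rows a, …, 2a-1 and the odd labels to the
-- rows 0, …, a-1, both in row-major order, but with the columns of the lower rows cyclically
-- rotated by f = n-e-1 ≥ e. Consecutive labels then lie a (or a+1) rows apart, and the rotation
-- keeps their columns at least e apart, so the labelling is (a+e)-dispersed.
-- Upper bound: every vertex has a far label-neighbour, and a vertex whose label is not an end
-- label has two distinct ones. For n = 2h+1 the centre (a,h) has eccentricity a+h. For n = 2g,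
-- each of (a,g), (a-1,g-1), (a,g-1) is within a+g-1 of every vertex but its opposite corner;
-- one of the three carries an interior label, so one of its two label-neighbours is that close.

module Submission where

open import Defs
open import Data.Nat
  using (ℕ; zero; suc; _+_; _*_; _∸_; _≤_; _<_; _≟_; z≤n; s≤s; s≤s⁻¹; ∣_-_∣; _≤?_; _<?_; _/_; _%_; NonZero; >-nonZero)
open import Data.Nat.DivMod using (m*n/n≡m; m≡m%n+[m/n]*n; m%n<n; [m+kn]%n≡m%n; m<n⇒m%n≡m; m<n*o⇒m/o<n)
open import Data.Nat.Properties
open import Data.Nat.Divisibility using (_∣_; divides)
open import Data.Fin using (Fin; toℕ; fromℕ<)
open import Data.Fin.Properties using (toℕ<n; toℕ-injective; toℕ-fromℕ<; fromℕ<-toℕ)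
open import Data.Product using (Σ; ∃; ∃₂; _×_; _,_; proj₁; proj₂)
open import Data.Sum using (_⊎_; inj₁; inj₂; [_,_])
open import Relation.Binary.Definitions using (Symmetric)
open import Relation.Binary.PropositionalEquality hiding ([_])
open import Relation.Nullary using (¬_; yes; no; contradiction)
open import Function.Base using (_∘_)
open import Function.Bundles using (_⤖_; Bijection; mk⤖)
open import Function.Consequences.Propositional using (strictlySurjective⇒surjective)

∣n-1+n∣≡1 : ∀ x → ∣ x - suc x ∣ ≡ 1
∣n-1+n∣≡1 zero    = refl
∣n-1+n∣≡1 (suc x) = ∣n-1+n∣≡1 x

∣m+n-m∣≡n : ∀ m n → ∣ m + n - m ∣ ≡ n
∣m+n-m∣≡n m n = trans (∣-∣-comm (m + n) m) (∣m-m+n∣≡n m n)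

n≤m+o∧m≤o⇒∣m-n∣≤o : ∀ {m n o} → n ≤ m + o → m ≤ o → ∣ m - n ∣ ≤ o
n≤m+o∧m≤o⇒∣m-n∣≤o {m} {n} n≤m+o m≤o with ∣m-n∣≡[m∸n]∨[n∸m] m n
... | inj₁ ∣m-n∣≡m∸n = ≤-trans (≤-reflexive ∣m-n∣≡m∸n) (≤-trans (m∸n≤m m n) m≤o)
... | inj₂ ∣m-n∣≡n∸m = ≤-trans (≤-reflexive ∣m-n∣≡n∸m) (m≤n+o⇒m∸n≤o n m n≤m+o)

2*n≡n+n : ∀ n → 2 * n ≡ n + n
2*n≡n+n n = cong (n +_) (+-identityʳ n)

below-or-above : ∀ c x → x < c ⊎ ∃ λ r → x ≡ r + c
below-or-above c x with c ≤? x
... | yes c≤x = inj₂ (x ∸ c , sym (m∸n+n≡m c≤x))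
... | no  c≰x = inj₁ (≰⇒> c≰x)

even-or-odd : ∀ t → (∃ λ h → t ≡ 2 * h) ⊎ (∃ λ h → t ≡ suc (2 * h))
even-or-odd zero = inj₁ (0 , refl)
even-or-odd (suc t) with even-or-odd t
... | inj₁ (h , refl) = inj₂ (h , refl)
... | inj₂ (h , refl) = inj₁ (suc h , sym (*-suc 2 h))

2∣⇒≡2* : ∀ {x} → 2 ∣ x → ∃ λ h → x ≡ 2 * h
2∣⇒≡2* (divides h x≡h*2) = h , trans x≡h*2 (*-comm h 2)

2∤1+2* : ∀ h → ¬ 2 ∣ suc (2 * h)
2∤1+2* h 2∣ with 2∣⇒≡2* 2∣
... | q , eq = even≢odd q h (sym eq)

*+-injective : ∀ {n q q′ r r′} → r < n → r′ < n → r + q * n ≡ r′ + q′ * n → r ≡ r′ × q ≡ q′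
*+-injective {n} {q} {q′} {r} {r′} r<n r′<n eq =
  r≡r′ , *-cancelʳ-≡ q q′ n (+-cancelˡ-≡ r _ _ (trans eq (cong (_+ q′ * n) (sym r≡r′))))
  where
  instance
    n-nonZero : NonZero n
    n-nonZero = >-nonZero (≤-<-trans z≤n r<n)
  r≡r′ : r ≡ r′
  r≡r′ = begin
    r                 ≡⟨ m<n⇒m%n≡m r<n ⟨
    r % n             ≡⟨ [m+kn]%n≡m%n r q n ⟨
    (r + q * n) % n   ≡⟨ cong (_% n) eq ⟩
    (r′ + q′ * n) % n ≡⟨ [m+kn]%n≡m%n r′ q′ n ⟩
    r′ % n            ≡⟨ m<n⇒m%n≡m r′<n ⟩
    r′                ∎
    where open ≡-Reasoning

*+-< : ∀ {n q Q r} → q < Q → r < n → r + q * n < Q * n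
*+-< {n} {q} q<Q r<n = ≤-trans (+-monoˡ-≤ (q * n) r<n) (*-monoˡ-≤ n q<Q)

m<n⇒1+2m<2n : ∀ {m n} → m < n → suc (2 * m) < 2 * n
m<n⇒1+2m<2n {m} m<n = ≤-trans (≤-reflexive (sym (*-suc 2 m))) (*-monoʳ-≤ 2 m<n)

-- Walks and distance in the grid

module _ {V : Set} {Adj : V → V → Set} where

  _▷_ : ∀ {u v w ℓ} → Walk Adj u v ℓ → Adj v w → Walk Adj u w (suc ℓ)
  here       ▷ e = step e here
  step e′ ws ▷ e = step e′ (ws ▷ e)

  _++ʷ_ : ∀ {u v w ℓ ℓ′} → Walk Adj u v ℓ → Walk Adj v w ℓ′ → Walk Adj u w (ℓ + ℓ′)
  here       ++ʷ ws′ = ws′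
  step e ws ++ʷ ws′ = step e (ws ++ʷ ws′)

  reverse : Symmetric Adj → ∀ {u v ℓ} → Walk Adj u v ℓ → Walk Adj v u ℓ
  reverse sym here        = here
  reverse sym (step e ws) = reverse sym ws ▷ sym e

  DistAtLeast-sym : Symmetric Adj → ∀ {u v k} → DistAtLeast Adj u v k → DistAtLeast Adj v u k
  DistAtLeast-sym sym d ℓ ws = d ℓ (reverse sym ws)

mapWalk : ∀ {V W : Set} {A : V → V → Set} {B : W → W → Set} (f : V → W) →
          (∀ {u v} → A u v → B (f u) (f v)) →
          ∀ {u v ℓ} → Walk A u v ℓ → Walk B (f u) (f v) ℓ
mapWalk f f-adj here        = here
mapWalk f f-adj (step e ws) = step (f-adj e) (mapWalk f f-adj ws)

module _ {n : ℕ} where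

  PathAdj-sym : Symmetric (PathAdj n)
  PathAdj-sym (inj₁ e) = inj₂ e
  PathAdj-sym (inj₂ e) = inj₁ e

  PathAdj⇒∣-∣≡1 : ∀ {i j} → PathAdj n i j → ∣ toℕ i - toℕ j ∣ ≡ 1
  PathAdj⇒∣-∣≡1 {i} (inj₁ i+1≡j) = subst (λ x → ∣ toℕ i - x ∣ ≡ 1) i+1≡j (∣n-1+n∣≡1 (toℕ i))
  PathAdj⇒∣-∣≡1 {j = j} (inj₂ j+1≡i) =
    subst (λ x → ∣ x - toℕ j ∣ ≡ 1) j+1≡i
          (trans (∣-∣-comm (suc (toℕ j)) (toℕ j)) (∣n-1+n∣≡1 (toℕ j)))

  ascendingWalk : ∀ (i j : Fin n) d → toℕ i + d ≡ toℕ j → Walk (PathAdj n) i j d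
  ascendingWalk i j zero i+0≡j with refl ← toℕ-injective (trans (sym (+-identityʳ _)) i+0≡j) = here
  ascendingWalk i j (suc d) i+d≡j =
    step (inj₁ (sym (toℕ-fromℕ< 1+i<n)))
         (ascendingWalk (fromℕ< 1+i<n) j d (trans (cong (_+ d) (toℕ-fromℕ< 1+i<n)) 1+i+d≡j))
    where
    1+i+d≡j : suc (toℕ i) + d ≡ toℕ j
    1+i+d≡j = trans (sym (+-suc (toℕ i) d)) i+d≡j
    1+i<n : suc (toℕ i) < n
    1+i<n = ≤-<-trans (≤-trans (m≤m+n (suc (toℕ i)) d) (≤-reflexive 1+i+d≡j)) (toℕ<n j)

  pathWalk : ∀ (i j : Fin n) → Walk (PathAdj n) i j ∣ toℕ i - toℕ j ∣
  pathWalk i j with ≤-total (toℕ i) (toℕ j)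
  ... | inj₁ i≤j = subst (Walk _ i j) (sym (m≤n⇒∣m-n∣≡n∸m i≤j)) (ascendingWalk i j _ (m+[n∸m]≡n i≤j))
  ... | inj₂ j≤i = subst (Walk _ i j) (sym (m≤n⇒∣n-m∣≡n∸m j≤i))
                         (reverse PathAdj-sym (ascendingWalk j i _ (m+[n∸m]≡n j≤i)))

module _ {m n : ℕ} where

  gridDist : GridV m n → GridV m n → ℕ
  gridDist (i , j) (i′ , j′) = ∣ toℕ i - toℕ i′ ∣ + ∣ toℕ j - toℕ j′ ∣

  gridWalk : ∀ u v → Walk (GridAdj m n) u v (gridDist u v)
  gridWalk (i , j) (i′ , j′) =
    mapWalk (_, j) (λ e → inj₁ (e , refl)) (pathWalk i i′) ++ʷ
    mapWalk (i′ ,_) (λ e → inj₂ (refl , e)) (pathWalk j j′)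

  gridDist-step : ∀ {u w} v → GridAdj m n u w → gridDist u v ≤ suc (gridDist w v)
  gridDist-step {i , _} {i′ , _} (i″ , _) (inj₁ (e , refl)) =
    +-monoˡ-≤ _ (≤-trans (∣-∣-triangle (toℕ i) (toℕ i′) (toℕ i″))
                         (≤-reflexive (cong (_+ _) (PathAdj⇒∣-∣≡1 e))))
  gridDist-step {i , j} {_ , j′} (_ , j″) (inj₂ (refl , e)) =
    ≤-trans (+-monoʳ-≤ _ (≤-trans (∣-∣-triangle (toℕ j) (toℕ j′) (toℕ j″))
                                   (≤-reflexive (cong (_+ _) (PathAdj⇒∣-∣≡1 e)))))
            (≤-reflexive (+-suc _ _))

  gridDist≤length : ∀ {u v ℓ} → Walk (GridAdj m n) u v ℓ → gridDist u v ≤ ℓ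
  gridDist≤length {i , j} here = ≤-reflexive (cong₂ _+_ (∣n-n∣≡0 (toℕ i)) (∣n-n∣≡0 (toℕ j)))
  gridDist≤length {v = v} (step e ws) = ≤-trans (gridDist-step v e) (s≤s (gridDist≤length ws))

  DistAtLeast⇒≤gridDist : ∀ {u v k} → DistAtLeast (GridAdj m n) u v k → k ≤ gridDist u v
  DistAtLeast⇒≤gridDist {u} {v} d = d _ (gridWalk u v)

  ≤gridDist⇒DistAtLeast : ∀ {u v k} → k ≤ gridDist u v → DistAtLeast (GridAdj m n) u v k
  ≤gridDist⇒DistAtLeast k≤d ℓ ws = ≤-trans k≤d (gridDist≤length ws)

  GridAdj-sym : Symmetric (GridAdj m n)
  GridAdj-sym (inj₁ (e , refl)) = inj₁ (PathAdj-sym e , refl)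
  GridAdj-sym (inj₂ (refl , e)) = inj₂ (refl , PathAdj-sym e)

module _ {V : Set} (Adj : V → V → Set) {N k : ℕ} (rank : V → ℕ)
         (rank< : ∀ v → rank v < N)
         (rank-injective : ∀ u v → rank u ≡ rank v → u ≡ v)
         (rank-surjective : ∀ t → t < N → Σ V λ v → rank v ≡ t)
         (rank-successor : ∀ u v → rank v ≡ suc (rank u) → DistAtLeast Adj u v k) where

  ranking⇒KDispersed : KDispersed Adj N k
  ranking⇒KDispersed = labelling , λ i 1+i<N →
    rank-successor _ _ (trans (rank-vertexAt-fromℕ< 1+i<N)
                              (cong suc (sym (rank-vertexAt-fromℕ< (<-trans (n<1+n i) 1+i<N)))))
    where
    vertexAt : Fin N → V
    vertexAt t = proj₁ (rank-surjective (toℕ t) (toℕ<n t))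

    rank-vertexAt : ∀ t → rank (vertexAt t) ≡ toℕ t
    rank-vertexAt t = proj₂ (rank-surjective (toℕ t) (toℕ<n t))

    labelling : Fin N ⤖ V
    labelling = mk⤖ (injective , strictlySurjective⇒surjective λ v → fromℕ< (rank< v) , section v)
      where
      injective : ∀ {s t} → vertexAt s ≡ vertexAt t → s ≡ t
      injective {s} {t} eq =
        toℕ-injective (trans (sym (rank-vertexAt s)) (trans (cong rank eq) (rank-vertexAt t)))
      section : ∀ v → vertexAt (fromℕ< (rank< v)) ≡ v
      section v = rank-injective _ _ (trans (rank-vertexAt _) (toℕ-fromℕ< (rank< v)))

    rank-vertexAt-fromℕ< : ∀ {i} .(i<N : i < N) → rank (vertexAt (fromℕ< i<N)) ≡ i
    rank-vertexAt-fromℕ< i<N = trans (rank-vertexAt _) (toℕ-fromℕ< i<N)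

record FarPair {V : Set} (Adj : V → V → Set) (k : ℕ) (v : V) : Set where
  field
    far₁ far₂ : V
    distinct  : far₁ ≢ far₂
    dist₁     : DistAtLeast Adj v far₁ k
    dist₂     : DistAtLeast Adj v far₂ k

Interior : ℕ → ℕ → Set
Interior N x = Σ ℕ λ i → x ≡ suc i × suc x < N

interior-or-end : ∀ {N} x → x < N → x ≡ 0 ⊎ suc x ≡ N ⊎ Interior N x
interior-or-end zero    _   = inj₁ refl
interior-or-end {N} (suc i) x<N with suc (suc i) <? N
... | yes x+1<N = inj₂ (inj₂ (i , refl , x+1<N))
... | no  x+1≮N = inj₂ (inj₁ (≤-antisym x<N (≮⇒≥ x+1≮N)))

oneOfThreeInterior : ∀ {N x y z} → x < N → y < N → z < N → x ≢ y → x ≢ z → y ≢ z →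
                     Interior N x ⊎ Interior N y ⊎ Interior N z
oneOfThreeInterior {x = x} {y} {z} x<N y<N z<N x≢y x≢z y≢z
  with interior-or-end x x<N | interior-or-end y y<N | interior-or-end z z<N
... | inj₂ (inj₂ int) | _ | _ = inj₁ int
... | _ | inj₂ (inj₂ int) | _ = inj₂ (inj₁ int)
... | _ | _ | inj₂ (inj₂ int) = inj₂ (inj₂ int)
... | inj₁ x≡0 | inj₁ y≡0 | _ = contradiction (trans x≡0 (sym y≡0)) x≢y
... | inj₁ x≡0 | _ | inj₁ z≡0 = contradiction (trans x≡0 (sym z≡0)) x≢z
... | _ | inj₁ y≡0 | inj₁ z≡0 = contradiction (trans y≡0 (sym z≡0)) y≢z
... | inj₂ (inj₁ x≡N) | inj₂ (inj₁ y≡N) | _ = contradiction (suc-injective (trans x≡N (sym y≡N))) x≢y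
... | inj₂ (inj₁ x≡N) | _ | inj₂ (inj₁ z≡N) = contradiction (suc-injective (trans x≡N (sym z≡N))) x≢z
... | _ | inj₂ (inj₁ y≡N) | inj₂ (inj₁ z≡N) = contradiction (suc-injective (trans y≡N (sym z≡N))) y≢z

module Dispersed {V : Set} {Adj : V → V → Set} (Adj-sym : Symmetric Adj)
                 {N k : ℕ} (K : KDispersed Adj N k) where

  open Bijection (proj₁ K) using (to; injective; strictlySurjective)

  vertexAt : ∀ {i} → .(i < N) → V
  vertexAt i<N = to (fromℕ< i<N)

  -- fromℕ< ignores its bound, so the proof of i < N used here need not be the one in KDispersed.
  consecutive : ∀ {i} .(i<N : i < N) (1+i<N : suc i < N) → DistAtLeast Adj (vertexAt i<N) (vertexAt 1+i<N) k
  consecutive i<N 1+i<N = proj₂ K _ 1+i<N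

  label : V → ℕ
  label v = toℕ (proj₁ (strictlySurjective v))

  label< : ∀ v → label v < N
  label< v = toℕ<n (proj₁ (strictlySurjective v))

  vertexAt-label : ∀ v → vertexAt (label< v) ≡ v
  vertexAt-label v = trans (cong to (fromℕ<-toℕ _ _)) (proj₂ (strictlySurjective v))

  label-injective : ∀ {u v} → label u ≡ label v → u ≡ v
  label-injective {u} {v} eq =
    trans (sym (proj₂ (strictlySurjective u)))
          (trans (cong to (toℕ-injective eq)) (proj₂ (strictlySurjective v)))

  hasFarVertex : 1 < N → ∀ v → Σ V λ w → DistAtLeast Adj v w k
  hasFarVertex 1<N v = subst (λ u → Σ V λ w → DistAtLeast Adj u w k) (vertexAt-label v) (atIndex (label< v))
    where
    atIndex : ∀ {i} (i<N : i < N) → Σ V λ w → DistAtLeast Adj (vertexAt i<N) w k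
    atIndex {zero}  0<N  = vertexAt 1<N , consecutive 0<N 1<N
    atIndex {suc i} i<N = vertexAt (<-trans (n<1+n i) i<N) , DistAtLeast-sym Adj-sym (consecutive _ i<N)

  interiorFarPair : ∀ {x} → Interior N x → (x<N : x < N) → FarPair Adj k (vertexAt x<N)
  interiorFarPair (i , refl , 1+x<N) x<N = record
    { far₁     = vertexAt (<-trans (n<1+n i) x<N)
    ; far₂     = vertexAt 1+x<N
    ; distinct = λ eq → m≢1+n+m i {1}
                   (trans (sym (toℕ-fromℕ< _)) (trans (cong toℕ (injective eq)) (toℕ-fromℕ< 1+x<N)))
    ; dist₁    = DistAtLeast-sym Adj-sym (consecutive _ x<N)
    ; dist₂    = consecutive x<N 1+x<N
    }

  farPairOfInterior : ∀ v → Interior N (label v) → FarPair Adj k v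
  farPairOfInterior v int = subst (FarPair Adj k) (vertexAt-label v) (interiorFarPair int (label< v))

  oneOfThreeHasFarPair : ∀ {u v w} → u ≢ v → u ≢ w → v ≢ w →
                         FarPair Adj k u ⊎ FarPair Adj k v ⊎ FarPair Adj k w
  oneOfThreeHasFarPair {u} {v} {w} u≢v u≢w v≢w
    with oneOfThreeInterior (label< u) (label< v) (label< w)
           (u≢v ∘ label-injective) (u≢w ∘ label-injective) (v≢w ∘ label-injective)
  ... | inj₁ int        = inj₁ (farPairOfInterior u int)
  ... | inj₂ (inj₁ int) = inj₂ (inj₁ (farPairOfInterior v int))
  ... | inj₂ (inj₂ int) = inj₂ (inj₂ (farPairOfInterior w int))

-- A dispersed labelling of the grid

module InterleavedLabelling (a e f : ℕ) (e≤f : e ≤ f) where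

  n : ℕ
  n = f + suc e

  0<n : 0 < n
  0<n = ≤-trans (s≤s z≤n) (m≤n+m (suc e) f)

  instance
    n-nonZero : NonZero n
    n-nonZero = >-nonZero 0<n

  -- y ↦ y + f (mod n) on {0, …, n-1}
  rotate : ℕ → ℕ
  rotate y with suc e ≤? y
  ... | yes _ = y ∸ suc e
  ... | no  _ = y + f

  rotate-low : ∀ {y} → y < suc e → rotate y ≡ y + f
  rotate-low {y} y<c with suc e ≤? y
  ... | yes c≤y = contradiction y<c (≤⇒≯ c≤y)
  ... | no  _   = refl

  rotate-high : ∀ r → rotate (r + suc e) ≡ r
  rotate-high r with suc e ≤? r + suc e
  ... | yes _   = m+n∸n≡m r (suc e)
  ... | no  c≰y = contradiction (m≤n+m (suc e) r) c≰y

  rotate< : ∀ {y} → y < n → rotate y < n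
  rotate< {y} y<n with below-or-above (suc e) y
  ... | inj₁ y<c rewrite rotate-low y<c = ≤-trans (+-monoˡ-< f y<c) (≤-reflexive (+-comm (suc e) f))
  ... | inj₂ (r , refl) rewrite rotate-high r = ≤-<-trans (m≤m+n r (suc e)) y<n

  low≢high : ∀ {y r} → y < suc e → r + suc e < n → rotate y ≢ rotate (r + suc e)
  low≢high {y} {r} y<c r+c<n eq = <⇒≱ (+-cancelʳ-< (suc e) r f r+c<n)
    (≤-trans (m≤n+m f y) (≤-reflexive (trans (sym (rotate-low y<c)) (trans eq (rotate-high r)))))

  rotate-injective : ∀ {y y′} → y < n → y′ < n → rotate y ≡ rotate y′ → y ≡ y′
  rotate-injective {y} {y′} y<n y′<n eq with below-or-above (suc e) y | below-or-above (suc e) y′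
  ... | inj₁ y<c | inj₁ y′<c =
    +-cancelʳ-≡ f y y′ (trans (sym (rotate-low y<c)) (trans eq (rotate-low y′<c)))
  ... | inj₂ (r , refl) | inj₂ (r′ , refl) =
    cong (_+ suc e) (trans (sym (rotate-high r)) (trans eq (rotate-high r′)))
  ... | inj₁ y<c | inj₂ (_ , refl) = contradiction eq (low≢high y<c y′<n)
  ... | inj₂ (_ , refl) | inj₁ y′<c = contradiction (sym eq) (low≢high y′<c y<n)

  rotate-surjective : ∀ {r} → r < n → ∃ λ y → y < n × rotate y ≡ r
  rotate-surjective {r} r<n with below-or-above f r
  ... | inj₁ r<f = r + suc e , +-monoˡ-< (suc e) r<f , rotate-high r
  ... | inj₂ (s , refl) = s , ≤-<-trans (m≤m+n s f) r<n , rotate-low s<c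
    where
    s<c : s < suc e
    s<c = +-cancelʳ-< f s (suc e) (subst (s + f <_) (+-comm f (suc e)) r<n)

  rotate-far : ∀ y → e ≤ ∣ y - rotate y ∣
  rotate-far y with below-or-above (suc e) y
  ... | inj₁ y<c rewrite rotate-low y<c | ∣m-m+n∣≡n y f = e≤f
  ... | inj₂ (r , refl) rewrite rotate-high r | ∣m+n-m∣≡n r (suc e) = n≤1+n e

  rotate-far-suc : ∀ y → e ≤ ∣ y - suc (rotate y) ∣
  rotate-far-suc y with below-or-above (suc e) y
  ... | inj₁ y<c rewrite rotate-low y<c | sym (+-suc y f) | ∣m-m+n∣≡n y (suc f) = m≤n⇒m≤1+n e≤f
  ... | inj₂ (r , refl) rewrite rotate-high r | +-suc r e | ∣m+n-m∣≡n r e = ≤-refl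

  rotate-last : ∀ y → suc (rotate y) ≡ n → e ≤ y
  rotate-last y last with below-or-above (suc e) y
  ... | inj₁ y<c rewrite rotate-low y<c =
    ≤-reflexive (suc-injective (+-cancelʳ-≡ f (suc e) (suc y) (trans (+-comm (suc e) f) (sym last))))
  ... | inj₂ (r , refl) = ≤-trans (n≤1+n e) (m≤n+m (suc e) r)

  rank : ℕ → ℕ → ℕ
  rank x y with a ≤? x
  ... | yes _ = 2 * (y + (x ∸ a) * n)
  ... | no  _ = suc (2 * (rotate y + x * n))

  rank-top : ∀ q y → rank (q + a) y ≡ 2 * (y + q * n)
  rank-top q y with a ≤? q + a
  ... | yes _   = cong (λ z → 2 * (y + z * n)) (m+n∸n≡m q a)
  ... | no  a≰x = contradiction (m≤n+m a q) a≰x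

  rank-bottom : ∀ {x} y → x < a → rank x y ≡ suc (2 * (rotate y + x * n))
  rank-bottom {x} y x<a with a ≤? x
  ... | yes a≤x = contradiction x<a (≤⇒≯ a≤x)
  ... | no  _   = refl

  rank< : ∀ {x y} → x < 2 * a → y < n → rank x y < 2 * a * n
  rank< {x} {y} x<2a y<n rewrite *-assoc 2 a n with below-or-above a x
  ... | inj₁ x<a rewrite rank-bottom y x<a = m<n⇒1+2m<2n (*+-< x<a (rotate< y<n))
  ... | inj₂ (q , refl) rewrite rank-top q y =
    *-monoʳ-< 2 (*+-< (+-cancelʳ-< a q a (subst (q + a <_) (2*n≡n+n a) x<2a)) y<n)

  rank-injective : ∀ {x y x′ y′} → y < n → y′ < n → rank x y ≡ rank x′ y′ → x ≡ x′ × y ≡ y′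
  rank-injective {x} {y} {x′} {y′} y<n y′<n eq with below-or-above a x | below-or-above a x′
  ... | inj₂ (q , refl) | inj₂ (q′ , refl) rewrite rank-top q y | rank-top q′ y′ =
    let y≡y′ , q≡q′ = *+-injective y<n y′<n (*-cancelˡ-≡ _ _ 2 eq) in cong (_+ a) q≡q′ , y≡y′
  ... | inj₁ x<a | inj₁ x′<a rewrite rank-bottom y x<a | rank-bottom y′ x′<a =
    let r≡r′ , x≡x′ = *+-injective (rotate< y<n) (rotate< y′<n) (*-cancelˡ-≡ _ _ 2 (suc-injective eq))
    in x≡x′ , rotate-injective y<n y′<n r≡r′
  ... | inj₂ (q , refl) | inj₁ x′<a rewrite rank-top q y | rank-bottom y′ x′<a =
    contradiction eq (even≢odd (y + q * n) (rotate y′ + x′ * n))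
  ... | inj₁ x<a | inj₂ (q′ , refl) rewrite rank-bottom y x<a | rank-top q′ y′ =
    contradiction (sym eq) (even≢odd (y′ + q′ * n) (rotate y + x * n))

  top<2a : ∀ {q} → q < a → q + a < 2 * a
  top<2a {q} q<a = subst (q + a <_) (sym (2*n≡n+n a)) (+-monoˡ-< a q<a)

  rank-surjective : ∀ {t} → t < 2 * a * n → ∃₂ λ x y → x < 2 * a × y < n × rank x y ≡ t
  rank-surjective {t} t<N with even-or-odd t
  ... | inj₁ (X , refl) = X / n + a , X % n , top<2a X/n<a , m%n<n X n ,
                          trans (rank-top (X / n) (X % n)) (cong (2 *_) (sym (m≡m%n+[m/n]*n X n)))
    where
    X/n<a : X / n < a
    X/n<a = m<n*o⇒m/o<n (*-cancelˡ-< 2 X (a * n) (subst (2 * X <_) (*-assoc 2 a n) t<N))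
  ... | inj₂ (X , refl) with rotate-surjective (m%n<n X n)
  ...   | y , y<n , rotate-y≡r = X / n , y , ≤-trans X/n<a (m≤m+n a (a + 0)) , y<n , rank≡t
    where
    X/n<a : X / n < a
    X/n<a = m<n*o⇒m/o<n (*-cancelˡ-< 2 X (a * n)
              (<-trans (n<1+n (2 * X)) (subst (suc (2 * X) <_) (*-assoc 2 a n) t<N)))
    rank≡t : rank (X / n) y ≡ suc (2 * X)
    rank≡t = begin
      rank (X / n) y                         ≡⟨ rank-bottom y X/n<a ⟩
      suc (2 * (rotate y + X / n * n))       ≡⟨ cong (λ r → suc (2 * (r + X / n * n))) rotate-y≡r ⟩
      suc (2 * (X % n + X / n * n))          ≡⟨ cong (λ z → suc (2 * z)) (m≡m%n+[m/n]*n X n) ⟨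
      suc (2 * X)                            ∎
      where open ≡-Reasoning

  top→bottom : ∀ {q x′ y y′} → y < n → y′ < n → rotate y′ + x′ * n ≡ y + q * n →
               a + e ≤ ∣ q + a - x′ ∣ + ∣ y - y′ ∣
  top→bottom {q} {x′} {y′ = y′} y<n y′<n eq
    with refl , refl ← *+-injective {q = x′} {q′ = q} (rotate< y′<n) y<n eq =
    +-mono-≤ (≤-reflexive (sym (∣m+n-m∣≡n q a))) (subst (e ≤_) (∣-∣-comm y′ _) (rotate-far y′))

  bottom→top : ∀ {x q′ y y′} → y < n → y′ < n → y′ + q′ * n ≡ suc (rotate y) + x * n →
               a + e ≤ ∣ x - q′ + a ∣ + ∣ y - y′ ∣
  bottom→top {x} {q′} {y} y<n y′<n eq with m≤n⇒m<n∨m≡n (rotate< y<n)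
  ... | inj₁ 1+r<n with refl , refl ← *+-injective {q = q′} {q′ = x} y′<n 1+r<n eq =
    +-mono-≤ (≤-reflexive (sym (∣m-m+n∣≡n x a))) (rotate-far-suc y)
  ... | inj₂ 1+r≡n
    with refl , refl ← *+-injective {q = q′} {q′ = suc x} {r′ = 0} y′<n 0<n
                                    (trans eq (cong (_+ x * n) 1+r≡n)) =
    begin
      a + e                          ≤⟨ +-mono-≤ (n≤1+n a) (rotate-last y 1+r≡n) ⟩
      suc a + y                      ≡⟨ cong₂ _+_ (∣m-m+n∣≡n x (suc a)) (∣-∣-identityʳ y) ⟨
      ∣ x - x + suc a ∣ + ∣ y - 0 ∣  ≡⟨ cong (λ z → ∣ x - z ∣ + ∣ y - 0 ∣) (+-suc x a) ⟩
      ∣ x - suc x + a ∣ + ∣ y - 0 ∣  ∎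
    where open ≤-Reasoning

  rank-successor : ∀ {x y x′ y′} → y < n → y′ < n → rank x′ y′ ≡ suc (rank x y) →
                   a + e ≤ ∣ x - x′ ∣ + ∣ y - y′ ∣
  rank-successor {x} {y} {x′} {y′} y<n y′<n eq with below-or-above a x | below-or-above a x′
  ... | inj₂ (q , refl) | inj₂ (q′ , refl) rewrite rank-top q y | rank-top q′ y′ =
    contradiction eq (even≢odd (y′ + q′ * n) (y + q * n))
  ... | inj₁ x<a | inj₁ x′<a rewrite rank-bottom y x<a | rank-bottom y′ x′<a =
    contradiction (suc-injective eq) (even≢odd (rotate y′ + x′ * n) (rotate y + x * n))
  ... | inj₂ (q , refl) | inj₁ x′<a rewrite rank-top q y | rank-bottom y′ x′<a =
    top→bottom {q} {x′} y<n y′<n (*-cancelˡ-≡ _ _ 2 (suc-injective eq))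
  ... | inj₁ x<a | inj₂ (q′ , refl) rewrite rank-bottom y x<a | rank-top q′ y′ =
    bottom→top {x} {q′} y<n y′<n (*-cancelˡ-≡ _ _ 2 (trans eq (sym (*-suc 2 _))))

  labelling : KDispersed (GridAdj (2 * a) n) (2 * a * n) (a + e)
  labelling = ranking⇒KDispersed (GridAdj (2 * a) n) rankV
    (λ (i , j) → rank< (toℕ<n i) (toℕ<n j))
    (λ (i , j) (i′ , j′) eq → let i≡i′ , j≡j′ = rank-injective (toℕ<n j) (toℕ<n j′) eq
                              in cong₂ _,_ (toℕ-injective i≡i′) (toℕ-injective j≡j′))
    rankV-surjective
    (λ (i , j) (i′ , j′) eq → ≤gridDist⇒DistAtLeast (rank-successor (toℕ<n j) (toℕ<n j′) eq))
    where
    rankV : GridV (2 * a) n → ℕ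
    rankV (i , j) = rank (toℕ i) (toℕ j)
    rankV-surjective : ∀ t → t < 2 * a * n → Σ (GridV (2 * a) n) λ v → rankV v ≡ t
    rankV-surjective t t<N with rank-surjective t<N
    ... | x , y , x<2a , y<n , rank≡t =
      (fromℕ< x<2a , fromℕ< y<n) , trans (cong₂ rank (toℕ-fromℕ< x<2a) (toℕ-fromℕ< y<n)) rank≡t

dispersedLabelling : ∀ a e n → 2 * e < n → KDispersed (GridAdj (2 * a) n) (2 * a * n) (a + e)
dispersedLabelling a e n 2e<n =
  subst (λ n → KDispersed (GridAdj (2 * a) n) (2 * a * n) (a + e)) (m∸n+n≡m 1+e≤n)
        (InterleavedLabelling.labelling a e (n ∸ suc e) (m+n≤o⇒m≤o∸n e e+1+e≤n))
  where
  e+1+e≤n : e + suc e ≤ n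
  e+1+e≤n = subst (_≤ n) (trans (cong suc (2*n≡n+n e)) (sym (+-suc e e))) 2e<n
  1+e≤n : suc e ≤ n
  1+e≤n = ≤-trans (m≤n+m (suc e) e) e+1+e≤n

-- Upper bounds

module MiddlesOfEvenPath (B : ℕ) where

  <2*1+B⇒≤B+1+B : ∀ {x} → x < 2 * suc B → x ≤ B + suc B
  <2*1+B⇒≤B+1+B {x} x< = s≤s⁻¹ (subst (x <_) (2*n≡n+n (suc B)) x<)

  first< : 0 < 2 * suc B
  first< = s≤s z≤n

  last< : B + suc B < 2 * suc B
  last< = subst (B + suc B <_) (sym (2*n≡n+n (suc B))) ≤-refl

  upper< : suc B < 2 * suc B
  upper< = ≤-<-trans (m≤n+m (suc B) B) last<

  lower< : B < 2 * suc B
  lower< = <-trans (n<1+n B) upper<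

  upper-eccentricity : ∀ x → x < 2 * suc B → ∣ suc B - x ∣ ≤ B ⊎ (x ≡ 0 × ∣ suc B - x ∣ ≡ suc B)
  upper-eccentricity zero    _  = inj₂ (refl , refl)
  upper-eccentricity (suc x) x< =
    inj₁ (n≤m+o∧m≤o⇒∣m-n∣≤o (s≤s⁻¹ (≤-trans (<2*1+B⇒≤B+1+B x<) (≤-reflexive (+-suc B B))))
                            ≤-refl)

  lower-eccentricity : ∀ x → x < 2 * suc B → ∣ B - x ∣ ≤ B ⊎ (x ≡ B + suc B × ∣ B - x ∣ ≡ suc B)
  lower-eccentricity x x< with x ≟ B + suc B
  ... | yes refl = inj₂ (refl , ∣m-m+n∣≡n B (suc B))
  ... | no  x≢   = inj₁ (n≤m+o∧m≤o⇒∣m-n∣≤o x≤B+B ≤-refl)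
    where
    x≤B+B : x ≤ B + B
    x≤B+B = s≤s⁻¹ (≤-trans (≤∧≢⇒< (<2*1+B⇒≤B+1+B x<) x≢) (≤-reflexive (+-suc B B)))

gridDist-fromℕ< : ∀ {m n x y} (x<m : x < m) (y<n : y < n) (i : Fin m) (j : Fin n) →
                  gridDist (fromℕ< x<m , fromℕ< y<n) (i , j) ≡ ∣ x - toℕ i ∣ + ∣ y - toℕ j ∣
gridDist-fromℕ< x<m y<n i j =
  cong₂ (λ x y → ∣ x - toℕ i ∣ + ∣ y - toℕ j ∣) (toℕ-fromℕ< x<m) (toℕ-fromℕ< y<n)

+-bound-unless-both-extreme : ∀ {P Q : Set} {r s B E} →
                              r ≤ B ⊎ (P × r ≡ suc B) → s ≤ E ⊎ (Q × s ≡ suc E) →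
                              r + s ≤ suc B + E ⊎ (P × Q)
+-bound-unless-both-extreme {r = r} {s} {B} {E} (inj₁ r≤B) s-bound =
  inj₁ (≤-trans (+-mono-≤ r≤B (s≤1+E s-bound)) (≤-reflexive (+-suc B E)))
  where
  s≤1+E : s ≤ E ⊎ (_ × s ≡ suc E) → s ≤ suc E
  s≤1+E (inj₁ s≤E)       = m≤n⇒m≤1+n s≤E
  s≤1+E (inj₂ (_ , s≡)) = ≤-reflexive s≡
+-bound-unless-both-extreme (inj₂ (_ , r≡)) (inj₁ s≤E) = inj₁ (+-mono-≤ (≤-reflexive r≡) s≤E)
+-bound-unless-both-extreme (inj₂ (p , _)) (inj₂ (q , _)) = inj₂ (p , q)

eccentricity-except :
  ∀ {m n B E cx cy ax ay} (cx<m : cx < m) (cy<n : cy < n) (ax<m : ax < m) (ay<n : ay < n) →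
  (∀ x → x < m → ∣ cx - x ∣ ≤ B ⊎ (x ≡ ax × ∣ cx - x ∣ ≡ suc B)) →
  (∀ y → y < n → ∣ cy - y ∣ ≤ E ⊎ (y ≡ ay × ∣ cy - y ∣ ≡ suc E)) →
  ∀ v → gridDist (fromℕ< cx<m , fromℕ< cy<n) v ≤ suc B + E ⊎ v ≡ (fromℕ< ax<m , fromℕ< ay<n)
eccentricity-except {B = B} {E} cx<m cy<n ax<m ay<n rows columns (i , j)
  with +-bound-unless-both-extreme (rows (toℕ i) (toℕ<n i)) (columns (toℕ j) (toℕ<n j))
... | inj₁ d = inj₁ (subst (_≤ suc B + E) (sym (gridDist-fromℕ< cx<m cy<n i j)) d)
... | inj₂ (i≡ax , j≡ay) = inj₂ (cong₂ _,_ (toℕ-injective (trans i≡ax (sym (toℕ-fromℕ< ax<m))))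
                                           (toℕ-injective (trans j≡ay (sym (toℕ-fromℕ< ay<n)))))

module GridBounds {m n k : ℕ} (K : KDispersed (GridAdj m n) (m * n) k) where

  open Dispersed GridAdj-sym K

  eccentricity-bound : 1 < m * n → ∀ C {D} → (∀ v → gridDist C v ≤ D) → k ≤ D
  eccentricity-bound 1<N C ecc =
    let w , far = hasFarVertex 1<N C in ≤-trans (DistAtLeast⇒≤gridDist far) (ecc w)

  farPair-bound : ∀ {C A D} → FarPair (GridAdj m n) k C → (∀ v → gridDist C v ≤ D ⊎ v ≡ A) → k ≤ D
  farPair-bound {C} {A} {D} fp ecc = bound (ecc far₁) (ecc far₂)
    where
    open FarPair fp
    bound : gridDist C far₁ ≤ D ⊎ far₁ ≡ A → gridDist C far₂ ≤ D ⊎ far₂ ≡ A → k ≤ D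
    bound (inj₁ d) _        = ≤-trans (DistAtLeast⇒≤gridDist dist₁) d
    bound (inj₂ _) (inj₁ d) = ≤-trans (DistAtLeast⇒≤gridDist dist₂) d
    bound (inj₂ p) (inj₂ q) = contradiction (trans p (sym q)) distinct

upperBound-odd : ∀ a h {k} → 0 < a → KDispersed (GridAdj (2 * a) (suc (2 * h))) (2 * a * suc (2 * h)) k →
                 k ≤ a + h
upperBound-odd a h 0<a K = GridBounds.eccentricity-bound K 1<N (fromℕ< a<2a , fromℕ< h<n) eccentricity
  where
  a<2a : a < 2 * a
  a<2a = subst (a <_) (sym (2*n≡n+n a)) (m<m+n a 0<a)
  h<n : h < suc (2 * h)
  h<n = s≤s (m≤m+n h (h + 0))
  1<N : 1 < 2 * a * suc (2 * h)
  1<N = ≤-trans (subst (1 <_) (sym (2*n≡n+n a)) (+-mono-≤ 0<a 0<a)) (m≤m*n (2 * a) (suc (2 * h)))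
  eccentricity : ∀ v → gridDist (fromℕ< a<2a , fromℕ< h<n) v ≤ a + h
  eccentricity (i , j) = subst (_≤ a + h) (sym (gridDist-fromℕ< a<2a h<n i j))
    (+-mono-≤ (n≤m+o∧m≤o⇒∣m-n∣≤o {a} (subst (toℕ i ≤_) (2*n≡n+n a) (<⇒≤ (toℕ<n i))) ≤-refl)
              (n≤m+o∧m≤o⇒∣m-n∣≤o {h} (subst (toℕ j ≤_) (2*n≡n+n h) (s≤s⁻¹ (toℕ<n j))) ≤-refl))

upperBound-even : ∀ b e {k} → KDispersed (GridAdj (2 * suc b) (2 * suc e)) (2 * suc b * (2 * suc e)) k →
                  k ≤ suc b + e
upperBound-even b e {k} K = [ bound₁ , [ bound₂ , bound₃ ] ] (oneOfThreeHasFarPair C₁≢C₂ C₁≢C₃ C₂≢C₃)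
  where
  module Row = MiddlesOfEvenPath b
  module Col = MiddlesOfEvenPath e
  open GridBounds K using (farPair-bound)
  open Dispersed GridAdj-sym K using (oneOfThreeHasFarPair)

  V : Set
  V = GridV (2 * suc b) (2 * suc e)

  C₁ C₂ C₃ : V
  C₁ = fromℕ< Row.upper< , fromℕ< Col.upper<
  C₂ = fromℕ< Row.lower< , fromℕ< Col.lower<
  C₃ = fromℕ< Row.upper< , fromℕ< Col.lower<

  bound₁ : FarPair (GridAdj _ _) k C₁ → k ≤ suc b + e
  bound₁ fp = farPair-bound fp (eccentricity-except Row.upper< Col.upper< Row.first< Col.first<
                                                    Row.upper-eccentricity Col.upper-eccentricity)
  bound₂ : FarPair (GridAdj _ _) k C₂ → k ≤ suc b + e
  bound₂ fp = farPair-bound fp (eccentricity-except Row.lower< Col.lower< Row.last< Col.last<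
                                                    Row.lower-eccentricity Col.lower-eccentricity)
  bound₃ : FarPair (GridAdj _ _) k C₃ → k ≤ suc b + e
  bound₃ fp = farPair-bound fp (eccentricity-except Row.upper< Col.lower< Row.first< Col.last<
                                                    Row.upper-eccentricity Col.lower-eccentricity)

  row : V → ℕ
  row = toℕ ∘ proj₁
  column : V → ℕ
  column = toℕ ∘ proj₂

  C₁≢C₂ : C₁ ≢ C₂
  C₁≢C₂ eq = 1+n≢n (trans (sym (toℕ-fromℕ< Row.upper<)) (trans (cong row eq) (toℕ-fromℕ< Row.lower<)))
  C₁≢C₃ : C₁ ≢ C₃
  C₁≢C₃ eq = 1+n≢n (trans (sym (toℕ-fromℕ< Col.upper<)) (trans (cong column eq) (toℕ-fromℕ< Col.lower<)))
  C₂≢C₃ : C₂ ≢ C₃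
  C₂≢C₃ eq = 1+n≢n (trans (sym (toℕ-fromℕ< Row.upper<)) (trans (cong row (sym eq)) (toℕ-fromℕ< Row.lower<)))

DL-even : ∀ b e → DLIs (GridAdj (2 * suc b) (2 * suc e)) (2 * suc b * (2 * suc e)) (suc b + e)
DL-even b e = dispersedLabelling (suc b) e (2 * suc e) (*-monoʳ-< 2 (n<1+n e)) , λ _ → upperBound-even b e

DL-odd : ∀ b h → DLIs (GridAdj (2 * suc b) (suc (2 * h))) (2 * suc b * suc (2 * h)) (suc b + h)
DL-odd b h =
  dispersedLabelling (suc b) h (suc (2 * h)) (n<1+n (2 * h)) , λ _ → upperBound-odd (suc b) h (s≤s z≤n)

half-of-double : ∀ x → 2 * x / 2 ≡ x
half-of-double x = trans (cong (_/ 2) (*-comm 2 x)) (m*n/n≡m x 2)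

half-of-even-sum : ∀ a g → (2 * a + 2 * suc g ∸ 2) / 2 ≡ a + g
half-of-even-sum a g = trans (cong (λ z → (z ∸ 2) / 2) sum≡) (half-of-double (a + g))
  where
  sum≡ : 2 * a + 2 * suc g ≡ 2 + 2 * (a + g)
  sum≡ = trans (sym (*-distribˡ-+ 2 a (suc g))) (trans (cong (2 *_) (+-suc a g)) (*-suc 2 (a + g)))

half-of-odd-sum : ∀ a h → (2 * a + suc (2 * h) ∸ 1) / 2 ≡ a + h
half-of-odd-sum a h = trans (cong (λ z → (z ∸ 1) / 2) sum≡) (half-of-double (a + h))
  where
  sum≡ : 2 * a + suc (2 * h) ≡ 1 + 2 * (a + h)
  sum≡ = trans (+-suc (2 * a) (2 * h)) (cong suc (sym (*-distribˡ-+ 2 a h)))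

theorem2p10 : (m n : ℕ) → 2 ≤ m → 2 ∣ m → 1 ≤ n →
    (2 ∣ n → DLIs (GridAdj m n) (m * n) ((m + n ∸ 2) / 2)) ×
    (¬ (2 ∣ n) → DLIs (GridAdj m n) (m * n) ((m + n ∸ 1) / 2))
theorem2p10 m n 2≤m 2∣m 1≤n with 2∣⇒≡2* 2∣m | even-or-odd n
... | zero , refl | _ = contradiction 2≤m λ ()
... | _ | inj₁ (zero , refl) = contradiction 1≤n λ ()
... | suc b , refl | inj₁ (suc e , refl) =
  (λ _ → subst (DLIs _ _) (sym (half-of-even-sum (suc b) e)) (DL-even b e)) ,
  (λ 2∤n → contradiction (divides (suc e) (*-comm 2 (suc e))) 2∤n)
... | suc b , refl | inj₂ (h , refl) =
  (λ 2∣n → contradiction 2∣n (2∤1+2* h)) ,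
  (λ _ → subst (DLIs _ _) (sym (half-of-odd-sum (suc b) h)) (DL-odd b h))
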